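{- Let $\Sigma$ and $\Pi$ be disjoint alphabets, $t\in(\Sigma\cup\Pi)^n$ a text and $p\in(\Sigma\cup\Pi)^m$ a pattern. Suppose $\mathrm{prev}(p)$ is represented in the augmented parameterized position heap $\mathrm{APPH}(t)$ by a node $u$. Then for every position $i$ of $t$, $p$ occurs at position $i$ in $t$ (i.e. $i+m-1\le n$ and $\mathrm{prev}(t[i:i+m-1])=\mathrm{prev}(p)$) if and only if $\mathrm{pmrp}(i)$ is $u$ or a descendant of $u$.
   Context: A p-string is a string over $\Sigma\cup\Pi$, where $\Sigma$ (constant symbols) and $\Pi$ (parameter symbols) are disjoint; $w[i:j]$ denotes a substring and $w[i:]=w[i:|w|]$. The prev-encoding $\mathrm{prev}(w)$ is the string $x$ of length $|w|$ over $\Sigma \cup \mathbb{N}$ with $x[i]=w[i]$ if $w[i]\in\Sigma$; $x[i]=0$ if $w[i]\in\Pi$ does not occur in $w[1:i-1]$; otherwise $x[i] = i - \max\{j<i : w[j]=w[i]\}$. A sequence hash tree $\mathrm{SHT}(w_1,\dots,w_n)$ is the trie (edges labeled by single symbols, nodes identified with root-to-node path labels) built by starting from a root and, for $k=1,\dots,n$, adding the node $p_k$ (as child of $w_k[1:|p_k|-1]$ via an edge labeled $w_k[|p_k|]$), where $p_k$ is the shortest prefix of $w_k$ not already a node, and doing nothing if no such prefix exists. The parameterized position heap is $\mathrm{PPH}(t)=\mathrm{SHT}(\mathrm{prev}(t[1:]),\dots,\mathrm{prev}(t[n:]))$; a string is represented in it if some node has that path label. For a position $i$, $\mathrm{pmrp}(i)$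 (parameterized maximal-reach pointer) is the deepest node of $\mathrm{PPH}(t)$ whose path label is a prefix of $\mathrm{prev}(t[i:])$. The augmented parameterized position heap $\mathrm{APPH}(t)$ is $\mathrm{PPH}(t)$ together with all pointers $\mathrm{pmrp}(i)$. A node counts as its own descendant for this purpose only via the explicit phrase "$u$ or a descendant of $u$". -}

module Defs where

open import Data.Nat using (ℕ; zero; suc; _+_; _∸_; _≤_)
open import Data.List using (List; []; _∷_; _++_; drop; take; length; upTo; map; inits)
open import Data.List.Properties using (≡-dec)
open import Data.Sum using (_⊎_; inj₁; inj₂)
open import Data.Sum.Properties using () renaming (≡-dec to ⊎-≡-dec)
open import Data.Nat.Properties using () renaming (_≟_ to _≟ℕ_)
open import Data.Product using (_×_; ∃-syntax)
open import Relation.Nullary using (yes; no)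
open import Relation.Binary.Definitions using (DecidableEquality)
open import Relation.Binary.PropositionalEquality using (_≡_)
import Data.List.Membership.DecPropositional as DecMem

-- Path labels / prefix order on strings:  u ≼ v  iff  u is a prefix of v.
-- In a trie whose nodes are identified with their path labels, "v is u or a
-- descendant of u" is exactly  u ≼ v.
_≼_ : {A : Set} → List A → List A → Set
u ≼ v = ∃[ s ] (u ++ s ≡ v)

-- Σ : constant symbols, Π : parameter symbols; disjointness is built in by
-- taking the alphabet of p-strings to be the disjoint union Σ ⊎ Π.
module PPH {Σ Π : Set} (_≟Σ_ : DecidableEquality Σ) (_≟Π_ : DecidableEquality Π) where

  Sym : Set
  Sym = Σ ⊎ Π

  PSym : Set
  PSym = Σ ⊎ ℕ

  _≟PS_ : DecidableEquality PSym
  _≟PS_ = ⊎-≡-dec _≟Σ_ _≟ℕ_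

  _≟PL_ : DecidableEquality (List PSym)
  _≟PL_ = ≡-dec _≟PS_

  open DecMem _≟PL_ using (_∈?_)

  -- The first argument is the already-read prefix in reverse order
  -- (most recent symbol first); result 0 if a does not occur.
  lookBack : Π → List Sym → ℕ → ℕ
  lookBack a []            k = 0
  lookBack a (inj₁ c ∷ r)  k = lookBack a r (suc k)
  lookBack a (inj₂ b ∷ r)  k with a ≟Π b
  ... | yes _ = k
  ... | no  _ = lookBack a r (suc k)

  prevAux : List Sym → List Sym → List PSym
  prevAux rev []           = []
  prevAux rev (inj₁ c ∷ w) = inj₁ c ∷ prevAux (inj₁ c ∷ rev) w
  prevAux rev (inj₂ a ∷ w) = inj₂ (lookBack a rev 1) ∷ prevAux (inj₂ a ∷ rev) w

  prev : List Sym → List PSym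
  prev = prevAux []

  -- Tries are represented by their (prefix-closed) set of nodes, each node
  -- identified with its path label.
  Trie : Set
  Trie = List (List PSym)

  addFirstNew : Trie → List (List PSym) → Trie
  addFirstNew N []       = N
  addFirstNew N (q ∷ qs) with q ∈? N
  ... | yes _ = addFirstNew N qs
  ... | no  _ = N ++ (q ∷ [])

  shtStep : Trie → List PSym → Trie
  shtStep N w = addFirstNew N (inits w)

  shtFrom : Trie → List (List PSym) → Trie
  shtFrom N []       = N
  shtFrom N (w ∷ ws) = shtFrom (shtStep N w) ws

  SHT : List (List PSym) → Trie
  SHT ws = shtFrom ([] ∷ []) ws

  -- t[i:] for 1-based position i
  suffixFrom : List Sym → ℕ → List Sym
  suffixFrom t i = drop (i ∸ 1) t

  PPHnodes : List Sym → Trie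
  PPHnodes t = SHT (map (λ j → prev (suffixFrom t (suc j))) (upTo (length t)))

  Represented : List PSym → Trie → Set
  Represented x N = x ∈ N
    where open import Data.List.Membership.Propositional using (_∈_)

  deepestIn : Trie → List PSym → List (List PSym) → List PSym
  deepestIn N best []       = best
  deepestIn N best (q ∷ qs) with q ∈? N
  ... | yes _ = deepestIn N q qs
  ... | no  _ = deepestIn N best qs

  pmrp : List Sym → ℕ → List PSym
  pmrp t i = deepestIn (PPHnodes t) [] (inits (prev (suffixFrom t i)))

  OccursAt : List Sym → List Sym → ℕ → Set
  OccursAt t p i = (i + length p ∸ 1 ≤ length t)
                 × (prev (take (length p) (suffixFrom t i)) ≡ prev p)

-- The prefixes of prev(t[i:]) form a chain, and pmrp(i) is the deepest of them
-- that is a node of the heap.  Hence a node x lies above pmrp(i) exactly when x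
-- is a prefix of prev(t[i:]).  Since prev commutes with taking prefixes, p
-- occurs at i exactly when prev(p) is a prefix of prev(t[i:]); applying the
-- first fact to the node x = prev(p) gives the theorem.
module Submission where

open import Defs
open import Data.Nat using (ℕ; zero; suc; _+_; _∸_; _≤_; s≤s; z≤n)
open import Data.Nat.Properties using (+-comm; <⇒≤; m≤o∸n⇒m+n≤o)
open import Data.List using (List; []; _∷_; _++_; take; drop; length; map; inits)
open import Data.List.Properties using (++-assoc; ++-identityʳ; length-drop; take++drop≡id)
open import Data.List.Membership.Propositional using (_∈_)
open import Data.List.Relation.Unary.All as All using (All; []; _∷_)
open import Data.List.Relation.Unary.All.Properties using (gmap⁺)
open import Data.List.Relation.Unary.AllPairs as AllPairs using (AllPairs; []; _∷_)
import Data.List.Relation.Unary.AllPairs.Properties as AllPairs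
open import Data.List.Relation.Unary.Any using (here; there)
open import Data.Sum using (_⊎_; inj₁; inj₂)
open import Data.Product using (_,_)
open import Data.Empty using (⊥-elim)
open import Function.Bundles using (_⇔_; mk⇔)
import Function.Properties.Equivalence as ⇔
open import Relation.Binary.Definitions using (DecidableEquality)
open import Relation.Binary.PropositionalEquality using (_≡_; refl; sym; trans; cong; subst; subst₂; module ≡-Reasoning)
open import Relation.Nullary using (yes; no)

module _ {A : Set} where

  ≼-refl : {a : List A} → a ≼ a
  ≼-refl {a} = [] , ++-identityʳ a

  ≼-trans : {a b c : List A} → a ≼ b → b ≼ c → a ≼ c
  ≼-trans {a} (s , refl) (r , refl) = s ++ r , sym (++-assoc a s r)

  []-≼ : (a : List A) → [] ≼ a
  []-≼ a = a , refl

  ∷-≼ : ∀ x {a b : List A} → a ≼ b → (x ∷ a) ≼ (x ∷ b)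
  ∷-≼ x (s , eq) = s , cong (x ∷_) eq

  take-≼ : ∀ k (w : List A) → take k w ≼ w
  take-≼ k w = drop k w , take++drop≡id k w

  ≼⇒take-length≡ : {a b : List A} → a ≼ b → take (length a) b ≡ a
  ≼⇒take-length≡ {[]}    _              = refl
  ≼⇒take-length≡ {x ∷ a} (s , refl) = cong (x ∷_) (≼⇒take-length≡ {a} (s , refl))

  ≼⇒length≤ : {a b : List A} → a ≼ b → length a ≤ length b
  ≼⇒length≤ {[]}    _          = z≤n
  ≼⇒length≤ {x ∷ a} (s , refl) = s≤s (≼⇒length≤ {a} (s , refl))

  ∈-map-∷ : ∀ x {a : List A} {qs} → a ∈ qs → (x ∷ a) ∈ map (x ∷_) qs
  ∈-map-∷ x (here refl) = here refl
  ∈-map-∷ x (there a∈qs) = there (∈-map-∷ x a∈qs)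

  take∈inits : ∀ k (w : List A) → take k w ∈ inits w
  take∈inits zero    w       = here refl
  take∈inits (suc k) []      = here refl
  take∈inits (suc k) (x ∷ w) = there (∈-map-∷ x (take∈inits k w))

  ≼⇒∈inits : {a b : List A} → a ≼ b → a ∈ inits b
  ≼⇒∈inits {a} {b} a≼b = subst (_∈ inits b) (≼⇒take-length≡ a≼b) (take∈inits (length a) b)

  inits-≼ : (w : List A) → All (_≼ w) (inits w)
  inits-≼ []      = ≼-refl ∷ []
  inits-≼ (x ∷ w) = []-≼ (x ∷ w) ∷ gmap⁺ (∷-≼ x) (inits-≼ w)

  inits-chain : (w : List A) → AllPairs _≼_ (inits w)
  inits-chain []      = [] ∷ []
  inits-chain (x ∷ w) =
    All.tabulate (λ {a} _ → []-≼ a) ∷ AllPairs.map⁺ (AllPairs.map (∷-≼ x) (inits-chain w))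

module _ {Σ Π : Set} (_≟Σ_ : DecidableEquality Σ) (_≟Π_ : DecidableEquality Π) where
  open PPH _≟Σ_ _≟Π_
  open import Data.List.Membership.DecPropositional _≟PL_ using (_∈?_)

  prevAux-take : ∀ rev k w → prevAux rev (take k w) ≡ take k (prevAux rev w)
  prevAux-take rev zero    w            = refl
  prevAux-take rev (suc k) []           = refl
  prevAux-take rev (suc k) (inj₁ c ∷ w) = cong (inj₁ c ∷_) (prevAux-take (inj₁ c ∷ rev) k w)
  prevAux-take rev (suc k) (inj₂ a ∷ w) = cong (_ ∷_) (prevAux-take (inj₂ a ∷ rev) k w)

  length-prevAux : ∀ rev w → length (prevAux rev w) ≡ length w
  length-prevAux rev []           = refl
  length-prevAux rev (inj₁ c ∷ w) = cong suc (length-prevAux (inj₁ c ∷ rev) w)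
  length-prevAux rev (inj₂ a ∷ w) = cong suc (length-prevAux (inj₂ a ∷ rev) w)

  deepestIn-≼ : ∀ N best qs {s} → All (_≼ s) qs → best ≼ s → deepestIn N best qs ≼ s
  deepestIn-≼ N best []       []           best≼s = best≼s
  deepestIn-≼ N best (q ∷ qs) (q≼s ∷ qs≼s) best≼s with q ∈? N
  ... | yes _ = deepestIn-≼ N q    qs qs≼s q≼s
  ... | no  _ = deepestIn-≼ N best qs qs≼s best≼s

  best-≼-deepestIn : ∀ N best qs → All (best ≼_) qs → AllPairs _≼_ qs → best ≼ deepestIn N best qs
  best-≼-deepestIn N best []       _                 _             = ≼-refl
  best-≼-deepestIn N best (q ∷ qs) (best≼q ∷ best≼qs) (q≼qs ∷ chain) with q ∈? N
  ... | yes _ = ≼-trans best≼q (best-≼-deepestIn N q qs q≼qs chain)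
  ... | no  _ = best-≼-deepestIn N best qs best≼qs chain

  node-≼-deepestIn : ∀ N best qs {x} → AllPairs _≼_ qs → x ∈ qs → x ∈ N → x ≼ deepestIn N best qs
  node-≼-deepestIn N best (q ∷ qs) (q≼qs ∷ chain) (here refl) x∈N with q ∈? N
  ... | yes _   = best-≼-deepestIn N q qs q≼qs chain
  ... | no  x∉N = ⊥-elim (x∉N x∈N)
  node-≼-deepestIn N best (q ∷ qs) (_ ∷ chain) (there x∈qs) x∈N with q ∈? N
  ... | yes _ = node-≼-deepestIn N q    qs chain x∈qs x∈N
  ... | no  _ = node-≼-deepestIn N best qs chain x∈qs x∈N

  node-≼-deepest-prefix⇔ : ∀ N w {x} → x ∈ N → (x ≼ deepestIn N [] (inits w) ⇔ x ≼ w)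
  node-≼-deepest-prefix⇔ N w x∈N = mk⇔
    (λ x≼d → ≼-trans x≼d (deepestIn-≼ N [] (inits w) (inits-≼ w) ([]-≼ w)))
    (λ x≼w → node-≼-deepestIn N [] (inits w) (inits-chain w) (≼⇒∈inits x≼w) x∈N)

  occursAt⇔prev-≼ : ∀ t p i → 1 ≤ i → i ≤ length t → OccursAt t p i ⇔ (prev p ≼ prev (suffixFrom t i))
  occursAt⇔prev-≼ t p (suc j) _ i≤n = mk⇔ occurs⇒≼ ≼⇒occurs
    where
      s = drop j t
      m = length p

      occurs⇒≼ : OccursAt t p (suc j) → prev p ≼ prev s
      occurs⇒≼ (_ , eq) = subst (_≼ prev s) (trans (sym (prevAux-take [] m s)) eq) (take-≼ m (prev s))

      ≼⇒occurs : prev p ≼ prev s → OccursAt t p (suc j)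
      ≼⇒occurs prev-p≼ = fits , matches
        where
          m≡ : length (prev p) ≡ m
          m≡ = length-prevAux [] p

          m≤ : m ≤ length t ∸ j
          m≤ = subst₂ _≤_ m≡ (trans (length-prevAux [] s) (length-drop j t)) (≼⇒length≤ prev-p≼)

          -- suc j + m ∸ 1 reduces to j + m
          fits : j + m ≤ length t
          fits = subst (_≤ length t) (+-comm m j) (m≤o∸n⇒m+n≤o m (<⇒≤ i≤n) m≤)

          matches : prev (take m s) ≡ prev p
          matches = begin
            prev (take m s)                  ≡⟨ prevAux-take [] m s ⟩
            take m (prev s)                  ≡⟨ cong (λ k → take k (prev s)) (sym m≡) ⟩
            take (length (prev p)) (prev s)  ≡⟨ ≼⇒take-length≡ prev-p≼ ⟩
            prev p                           ∎
            where open ≡-Reasoning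

mainTheorem5 : {Σ Π : Set} (_≟Σ_ : DecidableEquality Σ) (_≟Π_ : DecidableEquality Π)
    → (t p : List (Σ ⊎ Π))
    → PPH.Represented _≟Σ_ _≟Π_ (PPH.prev _≟Σ_ _≟Π_ p) (PPH.PPHnodes _≟Σ_ _≟Π_ t)
    → (i : ℕ) → 1 ≤ i → i ≤ length t
    → PPH.OccursAt _≟Σ_ _≟Π_ t p i ⇔ (PPH.prev _≟Σ_ _≟Π_ p ≼ PPH.pmrp _≟Σ_ _≟Π_ t i)
mainTheorem5 _≟Σ_ _≟Π_ t p prev-p∈PPH i 1≤i i≤n =
  ⇔.trans (occursAt⇔prev-≼ _≟Σ_ _≟Π_ t p i 1≤i i≤n)
          (⇔.sym (node-≼-deepest-prefix⇔ _≟Σ_ _≟Π_ (PPHnodes t) (prev (suffixFrom t i)) prev-p∈PPH))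
  where open PPH _≟Σ_ _≟Π_
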